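{- Let $n\geq 1$ be an integer, let $P_n=\langle a_0,\dots,a_k\rangle$ be the $n$-th $P$-sequence, and for each integer $s\geq 0$ let $F_{n,s}(x)=\sum_{i=0}^k a_i(i+x)^s$, a polynomial function over $\mathbb{R}$. Then $F_{n,s}(x)=0$ for all $x\in\mathbb{R}$, for every $s=0,1,\dots,n-1$.
   Context: Convention: $0^0=1$. $P$-sequences are defined recursively: $\langle 1,-1\rangle$ is a $P$-sequence; if $\langle a_0,\dots,a_k\rangle$ is a $P$-sequence with $a_0=-a_k$, then $\langle a_0,\dots,a_k,a_k,\dots,a_0\rangle$ (the sequence followed by its reversal) is a $P$-sequence; if $\langle a_0,\dots,a_k\rangle$ is a $P$-sequence with $a_0=a_k$, then $\langle a_0,\dots,a_{k-1},0,-a_{k-1},\dots,-a_0\rangle$ is a $P$-sequence; and only sequences obtained by finitely many applications of these clauses are $P$-sequences. Ordering the $P$-sequences by increasing length, $P_n$ denotes the $n$-th one; thus $P_1=\langle 1,-1\rangle$, $P_2=\langle 1,-1,-1,1\rangle$, $P_3=\langle 1,-1,-1,0,1,1,-1\rangle$, and each $P_{n+1}$ is obtained from $P_n$ by whichever of the two clauses applies. -}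

module Defs where

open import Level using (Level)
open import Data.Nat as ℕ using (ℕ; zero; suc)
open import Data.Integer as ℤ using (ℤ; +_; -[1+_])
open import Data.List using (List; []; _∷_; _++_; reverse; map; length)
open import Relation.Nullary using (yes; no)
open import Algebra.Bundles using (CommutativeRing; Semiring)
import Algebra.Definitions.RawSemiring as RawSemiringDefs

lastℤ : List ℤ → ℤ
lastℤ []          = + 0
lastℤ (x ∷ [])    = x
lastℤ (x ∷ y ∷ l) = lastℤ (y ∷ l)

initℤ : List ℤ → List ℤ
initℤ []          = []
initℤ (x ∷ [])    = []
initℤ (x ∷ y ∷ l) = x ∷ initℤ (y ∷ l)

-- One application of whichever P-sequence clause applies to a = ⟨a₀,…,a_k⟩:
--   a₀ = -a_k :  ⟨a₀,…,a_k, a_k,…,a₀⟩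
--   a₀ =  a_k :  ⟨a₀,…,a_{k-1}, 0, -a_{k-1},…,-a₀⟩
-- (if neither applies, the sequence is returned unchanged; this never
--  happens for P-sequences.)
step : List ℤ → List ℤ
step []        = []
step (a₀ ∷ as) with a₀ ℤ.≟ ℤ.- lastℤ (a₀ ∷ as)
... | yes _ = (a₀ ∷ as) ++ reverse (a₀ ∷ as)
... | no _ with a₀ ℤ.≟ lastℤ (a₀ ∷ as)
...   | yes _ = initℤ (a₀ ∷ as) ++ (+ 0 ∷ map ℤ.-_ (reverse (initℤ (a₀ ∷ as))))
...   | no _  = a₀ ∷ as

-- P n = the n-th P-sequence P_n (n ≥ 1): P₁ = ⟨1,-1⟩, P_{n+1} = step P_n.
-- (P 0 is a dummy value, never used.)
P : ℕ → List ℤ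
P zero          = []
P (suc zero)    = + 1 ∷ -[1+ 0 ] ∷ []
P (suc (suc n)) = step (P (suc n))

module _ {c ℓ : Level} (R : CommutativeRing c ℓ) where
  open CommutativeRing R
  open RawSemiringDefs (Semiring.rawSemiring semiring) using (_^_; _×_)

  ⟦_⟧ℤ : ℤ → Carrier
  ⟦ + n ⟧ℤ      = n × 1#
  ⟦ -[1+ n ] ⟧ℤ = - (suc n × 1#)

  -- Σ_{j} a_j (j + x)^s with j running from i (the index of the head)
  Fsum : ℕ → List ℤ → ℕ → Carrier → Carrier
  Fsum i []       s x = 0#
  Fsum i (a ∷ as) s x = ⟦ a ⟧ℤ * (((i × 1#) + x) ^ s) + Fsum (suc i) as s x

  -- F_{n,s}(x) = Σ_{i=0}^{k} a_i (i + x)^s   where P_n = ⟨a₀,…,a_k⟩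
  -- (_^_ satisfies x ^ 0 = 1#, so 0^0 = 1.)
  F : ℕ → ℕ → Carrier → Carrier
  F n s x = Fsum 0 (P n) s x

-- Write F_A(s, x) = Σ_i a_i (i + x)^s for a sequence A = ⟨a₀, …, a_k⟩.
-- P-sequences alternate between the shapes ⟨1, J, -1⟩ with J antipalindromic
-- and ⟨1, J, 1⟩ with J palindromic.  In either case the next sequence B
-- satisfies F_B(s, x) = F_A(s, x) - F_A(s, x + m) for some m: for the first
-- clause B is A followed by its negation, for the second the final 1 of A
-- cancels against the initial 1 of its reversed copy.  If F_A(s, ·) vanishes
-- for all s < n, then expanding (1 + y)^n shows F_A(n, x + 1) = F_A(n, x),
-- so F_A(n, ·) is invariant under integer shifts and F_B(s, ·) vanishes for
-- all s ≤ n.  Induction on n starts from ⟨1, -1⟩, the difference of ⟨1⟩ and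
-- its translate by 1.

module Submission where

open import Defs
open import Level using (Level; _⊔_)
open import Data.Nat as ℕ using (ℕ; zero; suc; _≤_; _<_; s≤s)
import Data.Nat.Properties as ℕP
open import Data.Integer as ℤ using (ℤ; +_; -[1+_])
import Data.Integer.Properties as ℤP
open import Algebra.Bundles using (CommutativeRing; Semiring)
open import Data.List using (List; []; _∷_; _++_; _∷ʳ_; reverse; map; length)
open import Data.List.Properties
  using (++-assoc; map-++; unfold-reverse; reverse-++; reverse-map; reverse-involutive)
open import Relation.Nullary using (yes; no; contradiction)
open import Relation.Binary.PropositionalEquality as ≡ using (_≡_; refl; sym; trans; cong; cong₂)
import Algebra.Definitions.RawSemiring as RawSemiringDefs
import Algebra.Properties.Ring as RingProperties
import Algebra.Properties.Semiring.Exp as ExpProperties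
import Algebra.Properties.CommutativeSemigroup as CommutativeSemigroupProperties

lastℤ-∷ʳ : ∀ x xs y → lastℤ (x ∷ xs ∷ʳ y) ≡ y
lastℤ-∷ʳ x []        y = refl
lastℤ-∷ʳ x (x′ ∷ xs) y = lastℤ-∷ʳ x′ xs y

initℤ-∷ʳ : ∀ x xs y → initℤ (x ∷ xs ∷ʳ y) ≡ x ∷ xs
initℤ-∷ʳ x []        y = refl
initℤ-∷ʳ x (x′ ∷ xs) y = cong (x ∷_) (initℤ-∷ʳ x′ xs y)

step-oppositeEnds : ∀ J → let A = + 1 ∷ J ∷ʳ -[1+ 0 ] in step A ≡ A ++ reverse A
step-oppositeEnds J with + 1 ℤ.≟ ℤ.- lastℤ (+ 1 ∷ J ∷ʳ -[1+ 0 ])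
... | yes _  = refl
... | no 1≢- = contradiction (sym (cong ℤ.-_ (lastℤ-∷ʳ (+ 1) J -[1+ 0 ]))) 1≢-

step-equalEnds : ∀ J →
  step (+ 1 ∷ J ∷ʳ + 1) ≡ (+ 1 ∷ J) ++ (+ 0 ∷ map ℤ.-_ (reverse (+ 1 ∷ J)))
step-equalEnds J with + 1 ℤ.≟ ℤ.- lastℤ (+ 1 ∷ J ∷ʳ + 1)
... | yes 1≡- = contradiction (trans 1≡- (cong ℤ.-_ (lastℤ-∷ʳ (+ 1) J (+ 1)))) λ ()
... | no _ with + 1 ℤ.≟ lastℤ (+ 1 ∷ J ∷ʳ + 1)
...   | yes _   = cong (λ I → I ++ + 0 ∷ map ℤ.-_ (reverse I)) (initℤ-∷ʳ (+ 1) J (+ 1))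
...   | no 1≢   = contradiction (sym (lastℤ-∷ʳ (+ 1) J (+ 1))) 1≢

map-neg-involutive : ∀ xs → map ℤ.-_ (map ℤ.-_ xs) ≡ xs
map-neg-involutive []       = refl
map-neg-involutive (x ∷ xs) = cong₂ _∷_ (ℤP.neg-involutive x) (map-neg-involutive xs)

reverse-∷-∷ʳ : ∀ {a} {X : Set a} (x : X) xs y → reverse (x ∷ xs ∷ʳ y) ≡ y ∷ reverse xs ∷ʳ x
reverse-∷-∷ʳ x xs y = trans (unfold-reverse x (xs ∷ʳ y)) (cong (_∷ʳ x) (reverse-++ xs (y ∷ [])))

++-reverse-∷-∷ʳ : ∀ {a} {X : Set a} (x : X) xs y →
  (x ∷ xs ∷ʳ y) ++ reverse (x ∷ xs ∷ʳ y) ≡ x ∷ (xs ++ y ∷ y ∷ reverse xs) ∷ʳ x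
++-reverse-∷-∷ʳ x xs y = begin
  (x ∷ xs ∷ʳ y) ++ reverse (x ∷ xs ∷ʳ y)   ≡⟨ cong ((x ∷ xs ∷ʳ y) ++_) (reverse-∷-∷ʳ x xs y) ⟩
  x ∷ (xs ∷ʳ y) ++ (y ∷ reverse xs ∷ʳ x)   ≡⟨ cong (x ∷_) (++-assoc xs (y ∷ []) _) ⟩
  x ∷ xs ++ y ∷ y ∷ reverse xs ∷ʳ x         ≡⟨ cong (x ∷_) (++-assoc xs (y ∷ y ∷ reverse xs) (x ∷ [])) ⟨
  x ∷ (xs ++ y ∷ y ∷ reverse xs) ∷ʳ x       ∎
  where open ≡.≡-Reasoning

reverse-++-++-reverse : ∀ {a} {X : Set a} (xs ys : List X) → reverse ys ≡ ys →
  reverse (xs ++ ys ++ reverse xs) ≡ xs ++ ys ++ reverse xs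
reverse-++-++-reverse xs ys ys-pal = begin
  reverse (xs ++ ys ++ reverse xs)                  ≡⟨ reverse-++ xs (ys ++ reverse xs) ⟩
  reverse (ys ++ reverse xs) ++ reverse xs          ≡⟨ cong (_++ reverse xs) (reverse-++ ys (reverse xs)) ⟩
  (reverse (reverse xs) ++ reverse ys) ++ reverse xs
    ≡⟨ cong₂ (λ u v → (u ++ v) ++ reverse xs) (reverse-involutive xs) ys-pal ⟩
  (xs ++ ys) ++ reverse xs                          ≡⟨ ++-assoc xs ys (reverse xs) ⟩
  xs ++ ys ++ reverse xs                            ∎
  where open ≡.≡-Reasoning

reverse-++-++-negReverse : ∀ xs ys → reverse ys ≡ map ℤ.-_ ys →
  let zs = xs ++ ys ++ map ℤ.-_ (reverse xs) in reverse zs ≡ map ℤ.-_ zs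
reverse-++-++-negReverse xs ys ys-anti = begin
  reverse (xs ++ ys ++ map ℤ.-_ (reverse xs))                 ≡⟨ reverse-++ xs _ ⟩
  reverse (ys ++ map ℤ.-_ (reverse xs)) ++ reverse xs         ≡⟨ cong (_++ reverse xs) (reverse-++ ys _) ⟩
  (reverse (map ℤ.-_ (reverse xs)) ++ reverse ys) ++ reverse xs
    ≡⟨ cong₂ (λ u v → (u ++ v) ++ reverse xs) reverse-negReverse ys-anti ⟩
  (map ℤ.-_ xs ++ map ℤ.-_ ys) ++ reverse xs                  ≡⟨ ++-assoc (map ℤ.-_ xs) _ _ ⟩
  map ℤ.-_ xs ++ map ℤ.-_ ys ++ reverse xs
    ≡⟨ cong (λ u → map ℤ.-_ xs ++ map ℤ.-_ ys ++ u) (map-neg-involutive (reverse xs)) ⟨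
  map ℤ.-_ xs ++ map ℤ.-_ ys ++ map ℤ.-_ (map ℤ.-_ (reverse xs))
    ≡⟨ cong (map ℤ.-_ xs ++_) (map-++ ℤ.-_ ys _) ⟨
  map ℤ.-_ xs ++ map ℤ.-_ (ys ++ map ℤ.-_ (reverse xs))       ≡⟨ map-++ ℤ.-_ xs _ ⟨
  map ℤ.-_ (xs ++ ys ++ map ℤ.-_ (reverse xs))                ∎
  where
  open ≡.≡-Reasoning
  reverse-negReverse : reverse (map ℤ.-_ (reverse xs)) ≡ map ℤ.-_ xs
  reverse-negReverse = trans (sym (reverse-map ℤ.-_ (reverse xs)))
                             (cong (λ u → map ℤ.-_ u) (reverse-involutive xs))

++-∷-negReverse : ∀ x xs y →
  (x ∷ xs) ++ y ∷ map ℤ.-_ (reverse (x ∷ xs)) ≡ x ∷ (xs ++ y ∷ map ℤ.-_ (reverse xs)) ∷ʳ ℤ.- x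
++-∷-negReverse x xs y = cong (x ∷_) (begin
  xs ++ y ∷ map ℤ.-_ (reverse (x ∷ xs))
    ≡⟨ cong (λ u → xs ++ y ∷ map ℤ.-_ u) (unfold-reverse x xs) ⟩
  xs ++ y ∷ map ℤ.-_ (reverse xs ∷ʳ x)
    ≡⟨ cong (λ u → xs ++ y ∷ u) (map-++ ℤ.-_ (reverse xs) (x ∷ [])) ⟩
  xs ++ (y ∷ map ℤ.-_ (reverse xs)) ∷ʳ ℤ.- x
    ≡⟨ ++-assoc xs (y ∷ map ℤ.-_ (reverse xs)) (ℤ.- x ∷ []) ⟨
  (xs ++ y ∷ map ℤ.-_ (reverse xs)) ∷ʳ ℤ.- x ∎)
  where open ≡.≡-Reasoning

data Shape : List ℤ → Set where
  antipalindromic : ∀ {J} → reverse J ≡ map ℤ.-_ J → Shape (+ 1 ∷ J ∷ʳ -[1+ 0 ])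
  palindromic     : ∀ {J} → reverse J ≡ J → Shape (+ 1 ∷ J ∷ʳ + 1)

antipalindromic-reverse : ∀ {J} → reverse J ≡ map ℤ.-_ J →
  let A = + 1 ∷ J ∷ʳ -[1+ 0 ] in reverse A ≡ map ℤ.-_ A
antipalindromic-reverse {J} J-anti = begin
  reverse (+ 1 ∷ J ∷ʳ -[1+ 0 ])     ≡⟨ reverse-∷-∷ʳ (+ 1) J -[1+ 0 ] ⟩
  -[1+ 0 ] ∷ reverse J ∷ʳ + 1       ≡⟨ cong (λ u → -[1+ 0 ] ∷ u ∷ʳ + 1) J-anti ⟩
  -[1+ 0 ] ∷ map ℤ.-_ J ∷ʳ + 1      ≡⟨ cong (-[1+ 0 ] ∷_) (map-++ ℤ.-_ J (-[1+ 0 ] ∷ [])) ⟨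
  map ℤ.-_ (+ 1 ∷ J ∷ʳ -[1+ 0 ])    ∎
  where open ≡.≡-Reasoning

palindromic-reverse : ∀ {J} → reverse J ≡ J → + 1 ∷ J ∷ʳ + 1 ≡ + 1 ∷ reverse (+ 1 ∷ J)
palindromic-reverse {J} J-pal =
  cong (+ 1 ∷_) (trans (cong (_∷ʳ + 1) (sym J-pal)) (sym (unfold-reverse (+ 1) J)))

-- The new inner part is (anti)palindromic for every J; the hypothesis on J is
-- needed only for the difference identity of the step.
step-Shape : ∀ {A} → Shape A → Shape (step A)
step-Shape (antipalindromic {J} _) rewrite step-oppositeEnds J | ++-reverse-∷-∷ʳ (+ 1) J -[1+ 0 ] =
  palindromic (reverse-++-++-reverse J (-[1+ 0 ] ∷ -[1+ 0 ] ∷ []) refl)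
step-Shape (palindromic {J} _) rewrite step-equalEnds J | ++-∷-negReverse (+ 1) J (+ 0) =
  antipalindromic (reverse-++-++-negReverse J (+ 0 ∷ []) refl)

P-Shape : ∀ n → Shape (P (suc n))
P-Shape zero    = antipalindromic {J = []} refl
P-Shape (suc n) = step-Shape (P-Shape n)

module _ {c ℓ : Level} (R : CommutativeRing c ℓ) where
  open CommutativeRing R hiding (refl; sym; trans)
  open CommutativeRing R using () renaming (refl to ≈-refl; sym to ≈-sym; trans to ≈-trans)
  open RawSemiringDefs (Semiring.rawSemiring semiring) using (_^_; _×_)
  open RingProperties ring using (-0#≈0#; -‿involutive; -‿distribˡ-*; -‿+-comm)
  open ExpProperties semiring using (^-congˡ)
  open CommutativeSemigroupProperties +-commutativeSemigroup using (interchange; xy∙z≈y∙xz)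
  open import Relation.Binary.Reasoning.Setoid setoid

  private
    ⟦_⟧ : ℤ → Carrier
    ⟦_⟧ = ⟦_⟧ℤ R

  ⟦-⟧ℤ : ∀ a → ⟦ ℤ.- a ⟧ ≈ - ⟦ a ⟧
  ⟦-⟧ℤ (+ zero)  = ≈-sym -0#≈0#
  ⟦-⟧ℤ (+ suc n) = ≈-refl
  ⟦-⟧ℤ -[1+ n ]  = ≈-sym (-‿involutive _)

  Fsum-suc : ∀ i A s x → Fsum R (suc i) A s x ≈ Fsum R i A s (1# + x)
  Fsum-suc i []      s x = ≈-refl
  Fsum-suc i (a ∷ A) s x =
    +-cong (*-congˡ (^-congˡ s (xy∙z≈y∙xz 1# (i × 1#) x))) (Fsum-suc (suc i) A s x)

  Fsum-++ : ∀ i A C s x → Fsum R i (A ++ C) s x ≈ Fsum R i A s x + Fsum R (i ℕ.+ length A) C s x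
  Fsum-++ i []      C s x = ≈-trans
    (reflexive (cong (λ k → Fsum R k C s x) (sym (ℕP.+-identityʳ i)))) (≈-sym (+-identityˡ _))
  Fsum-++ i (a ∷ A) C s x = begin
    ⟦ a ⟧ * y + Fsum R (suc i) (A ++ C) s x
      ≈⟨ +-congˡ (Fsum-++ (suc i) A C s x) ⟩
    ⟦ a ⟧ * y + (Fsum R (suc i) A s x + Fsum R (suc i ℕ.+ length A) C s x)
      ≈⟨ +-assoc _ _ _ ⟨
    (⟦ a ⟧ * y + Fsum R (suc i) A s x) + Fsum R (suc i ℕ.+ length A) C s x
      ≈⟨ +-congˡ (reflexive (cong (λ k → Fsum R k C s x) (sym (ℕP.+-suc i (length A))))) ⟩
    (⟦ a ⟧ * y + Fsum R (suc i) A s x) + Fsum R (i ℕ.+ length (a ∷ A)) C s x ∎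
    where y = ((i × 1#) + x) ^ s

  Fsum-neg : ∀ i A s x → Fsum R i (map ℤ.-_ A) s x ≈ - Fsum R i A s x
  Fsum-neg i []      s x = ≈-sym -0#≈0#
  Fsum-neg i (a ∷ A) s x = begin
    ⟦ ℤ.- a ⟧ * y + Fsum R (suc i) (map ℤ.-_ A) s x  ≈⟨ +-cong (*-congʳ (⟦-⟧ℤ a)) (Fsum-neg (suc i) A s x) ⟩
    - ⟦ a ⟧ * y + - Fsum R (suc i) A s x             ≈⟨ +-congʳ (-‿distribˡ-* _ _) ⟨
    - (⟦ a ⟧ * y) + - Fsum R (suc i) A s x           ≈⟨ -‿+-comm _ _ ⟩
    - (⟦ a ⟧ * y + Fsum R (suc i) A s x)             ∎
    where y = ((i × 1#) + x) ^ s

  Fsum-++-neg : ∀ A C s x →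
    Fsum R 0 (A ++ map ℤ.-_ C) s x ≈ Fsum R 0 A s x - Fsum R (length A) C s x
  Fsum-++-neg A C s x = ≈-trans (Fsum-++ 0 A (map ℤ.-_ C) s x) (+-congˡ (Fsum-neg (length A) C s x))

  VanishesBelow : ℕ → List ℤ → Set (c ⊔ ℓ)
  VanishesBelow n A = ∀ s → s < n → ∀ x → Fsum R 0 A s x ≈ 0#

  VanishesBelow-≤ : ∀ {m n} A → m ≤ n → VanishesBelow n A → VanishesBelow m A
  VanishesBelow-≤ A m≤n v s s<m = v s (ℕP.<-≤-trans s<m m≤n)

  -- Σ_j a_j y_j^s (1 + y_j)^t with y_j = i + j + x.  Its Pascal recursion in t
  -- expands (1 + y)^n without binomial coefficients.
  mixedSum : ℕ → List ℤ → ℕ → ℕ → Carrier → Carrier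
  mixedSum i []      s t x = 0#
  mixedSum i (a ∷ A) s t x = ⟦ a ⟧ * (y ^ s * (1# + y) ^ t) + mixedSum (suc i) A s t x
    where y = (i × 1#) + x

  mixedSum-zeroʳ : ∀ i A s x → mixedSum i A s 0 x ≈ Fsum R i A s x
  mixedSum-zeroʳ i []      s x = ≈-refl
  mixedSum-zeroʳ i (a ∷ A) s x = +-cong (*-congˡ (*-identityʳ _)) (mixedSum-zeroʳ (suc i) A s x)

  mixedSum-zeroˡ : ∀ i A t x → mixedSum i A 0 t x ≈ Fsum R (suc i) A t x
  mixedSum-zeroˡ i []      t x = ≈-refl
  mixedSum-zeroˡ i (a ∷ A) t x =
    +-cong (*-congˡ (≈-trans (*-identityˡ _) (^-congˡ t (≈-sym (+-assoc 1# (i × 1#) x)))))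
           (mixedSum-zeroˡ (suc i) A t x)

  pascal : ∀ y p q → p * ((1# + y) * q) ≈ p * q + (y * p) * q
  pascal y p q = begin
    p * ((1# + y) * q)    ≈⟨ *-congˡ (distribʳ q 1# y) ⟩
    p * (1# * q + y * q)  ≈⟨ *-congˡ (+-congʳ (*-identityˡ q)) ⟩
    p * (q + y * q)       ≈⟨ distribˡ p q (y * q) ⟩
    p * q + p * (y * q)   ≈⟨ +-congˡ (*-assoc p y q) ⟨
    p * q + (p * y) * q   ≈⟨ +-congˡ (*-congʳ (*-comm p y)) ⟩
    p * q + (y * p) * q   ∎

  mixedSum-suc : ∀ i A s t x →
    mixedSum i A s (suc t) x ≈ mixedSum i A s t x + mixedSum i A (suc s) t x
  mixedSum-suc i []      s t x = ≈-sym (+-identityˡ 0#)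
  mixedSum-suc i (a ∷ A) s t x = ≈-trans
    (+-cong (≈-trans (*-congˡ (pascal _ _ _)) (distribˡ _ _ _)) (mixedSum-suc (suc i) A s t x))
    (interchange _ _ _ _)

  mixedSum-collapse : ∀ {d} A t s → VanishesBelow d A → s ℕ.+ t ≡ d → ∀ x →
    mixedSum 0 A s t x ≈ Fsum R 0 A d x
  mixedSum-collapse A zero s v refl x =
    ≈-trans (mixedSum-zeroʳ 0 A s x) (reflexive (cong (λ k → Fsum R 0 A k x) (sym (ℕP.+-identityʳ s))))
  mixedSum-collapse A (suc t) s v refl x = begin
    mixedSum 0 A s (suc t) x                         ≈⟨ mixedSum-suc 0 A s t x ⟩
    mixedSum 0 A s t x + mixedSum 0 A (suc s) t x    ≈⟨ +-cong lower higher ⟩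
    0# + Fsum R 0 A (s ℕ.+ suc t) x                  ≈⟨ +-identityˡ _ ⟩
    Fsum R 0 A (s ℕ.+ suc t) x                       ∎
    where
    s+t<s+1+t : s ℕ.+ t < s ℕ.+ suc t
    s+t<s+1+t = ℕP.+-monoʳ-< s (ℕP.n<1+n t)
    lower : mixedSum 0 A s t x ≈ 0#
    lower = ≈-trans (mixedSum-collapse A t s (VanishesBelow-≤ A (ℕP.<⇒≤ s+t<s+1+t) v) refl x)
                    (v (s ℕ.+ t) s+t<s+1+t x)
    higher : mixedSum 0 A (suc s) t x ≈ Fsum R 0 A (s ℕ.+ suc t) x
    higher = mixedSum-collapse A t (suc s) v (sym (ℕP.+-suc s t)) x

  Fsum-one≈zero : ∀ {n} A → VanishesBelow n A → ∀ x → Fsum R 1 A n x ≈ Fsum R 0 A n x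
  Fsum-one≈zero {n} A v x = ≈-trans (≈-sym (mixedSum-zeroˡ 0 A n x)) (mixedSum-collapse A n 0 v refl x)

  Fsum-periodic : ∀ A {s} → (∀ x → Fsum R 1 A s x ≈ Fsum R 0 A s x) →
    ∀ m x → Fsum R m A s x ≈ Fsum R 0 A s x
  Fsum-periodic A p zero    x = ≈-refl
  Fsum-periodic A {s} p (suc m) x = begin
    Fsum R (suc m) A s x  ≈⟨ Fsum-suc m A s x ⟩
    Fsum R m A s (1# + x) ≈⟨ Fsum-periodic A p m (1# + x) ⟩
    Fsum R 0 A s (1# + x) ≈⟨ Fsum-suc 0 A s x ⟨
    Fsum R 1 A s x        ≈⟨ p x ⟩
    Fsum R 0 A s x        ∎

  record IsShiftDifference (B A : List ℤ) : Set (c ⊔ ℓ) where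
    field
      shift      : ℕ
      difference : ∀ s x → Fsum R 0 B s x ≈ Fsum R 0 A s x - Fsum R shift A s x

  VanishesBelow-suc : ∀ {n A B} → VanishesBelow n A → IsShiftDifference B A → VanishesBelow (suc n) B
  VanishesBelow-suc {A = A} {B} v B-A s (s≤s s≤n) x = begin
    Fsum R 0 B s x                    ≈⟨ difference s x ⟩
    Fsum R 0 A s x - Fsum R shift A s x
      ≈⟨ +-congˡ (-‿cong (Fsum-periodic A (Fsum-one≈zero A (VanishesBelow-≤ A s≤n v)) shift x)) ⟩
    Fsum R 0 A s x - Fsum R 0 A s x   ≈⟨ -‿inverseʳ _ ⟩
    0#                                ∎
    where open IsShiftDifference B-A

  Fsum-transfer : ∀ I a T s x →
    Fsum R 0 I s x - Fsum R (length I) (+ 0 ∷ T) s x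
      ≈ Fsum R 0 (I ∷ʳ a) s x - Fsum R (length I) (a ∷ T) s x
  Fsum-transfer I a T s x = begin
    Fsum R 0 I s x - (⟦ + 0 ⟧ * z + r)   ≈⟨ +-congˡ (-‿cong (≈-trans (+-congʳ (zeroˡ z)) (+-identityˡ r))) ⟩
    Fsum R 0 I s x - r                   ≈⟨ x+y-[y+z]≈x-z (Fsum R 0 I s x) u r ⟨
    (Fsum R 0 I s x + u) - (u + r)       ≈⟨ +-congʳ (≈-trans (Fsum-++ 0 I (a ∷ []) s x) (+-congˡ (+-identityʳ u))) ⟨
    Fsum R 0 (I ∷ʳ a) s x - (u + r)      ∎
    where
    z = ((length I × 1#) + x) ^ s
    u = ⟦ a ⟧ * z
    r = Fsum R (suc (length I)) T s x
    x+y-[y+z]≈x-z : ∀ p q t → (p + q) - (q + t) ≈ p - t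
    x+y-[y+z]≈x-z p q t = begin
      (p + q) - (q + t)        ≈⟨ +-congˡ (-‿+-comm q t) ⟨
      (p + q) + (- q + - t)    ≈⟨ +-assoc p q _ ⟩
      p + (q + (- q + - t))    ≈⟨ +-congˡ (+-assoc q (- q) (- t)) ⟨
      p + ((q - q) + - t)      ≈⟨ +-congˡ (+-congʳ (-‿inverseʳ q)) ⟩
      p + (0# + - t)           ≈⟨ +-congˡ (+-identityˡ (- t)) ⟩
      p - t                    ∎

  step-IsShiftDifference : ∀ {A} → Shape A → IsShiftDifference (step A) A
  step-IsShiftDifference (antipalindromic {J} J-anti) = record { shift = length A ; difference = λ s x → begin
    Fsum R 0 (step A) s x                       ≡⟨ cong (λ B → Fsum R 0 B s x) (step-oppositeEnds J) ⟩
    Fsum R 0 (A ++ reverse A) s x               ≡⟨ cong (λ B → Fsum R 0 (A ++ B) s x) (antipalindromic-reverse J-anti) ⟩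
    Fsum R 0 (A ++ map ℤ.-_ A) s x              ≈⟨ Fsum-++-neg A A s x ⟩
    Fsum R 0 A s x - Fsum R (length A) A s x    ∎ }
    where A = + 1 ∷ J ∷ʳ -[1+ 0 ]
  step-IsShiftDifference (palindromic {J} J-pal) = record { shift = length I ; difference = λ s x → begin
    Fsum R 0 (step A) s x                                     ≡⟨ cong (λ B → Fsum R 0 B s x) (step-equalEnds J) ⟩
    Fsum R 0 (I ++ map ℤ.-_ (+ 0 ∷ reverse I)) s x            ≈⟨ Fsum-++-neg I (+ 0 ∷ reverse I) s x ⟩
    Fsum R 0 I s x - Fsum R (length I) (+ 0 ∷ reverse I) s x  ≈⟨ Fsum-transfer I (+ 1) (reverse I) s x ⟩
    Fsum R 0 A s x - Fsum R (length I) (+ 1 ∷ reverse I) s x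
      ≡⟨ cong (λ B → Fsum R 0 A s x - Fsum R (length I) B s x) (palindromic-reverse J-pal) ⟨
    Fsum R 0 A s x - Fsum R (length I) A s x                  ∎ }
    where
    I = + 1 ∷ J
    A = I ∷ʳ + 1

  P₁-IsShiftDifference : IsShiftDifference (P 1) (+ 1 ∷ [])
  P₁-IsShiftDifference = record { shift = 1 ; difference = Fsum-++-neg (+ 1 ∷ []) (+ 1 ∷ []) }

  P-vanishes : ∀ n → VanishesBelow (suc n) (P (suc n))
  P-vanishes zero    = VanishesBelow-suc (λ _ ()) P₁-IsShiftDifference
  P-vanishes (suc n) = VanishesBelow-suc (P-vanishes n) (step-IsShiftDifference (P-Shape n))

lemma1 : {c ℓ : Level} (R : CommutativeRing c ℓ) (n : ℕ) → 1 ≤ n →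
         (s : ℕ) → s < n → (x : CommutativeRing.Carrier R) →
         CommutativeRing._≈_ R (F R n s x) (CommutativeRing.0# R)
lemma1 R (suc n) _ = P-vanishes R n
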